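{- Let $t\ge 1$ and let $p$ be a permutation of $\{1,\dots,n-1\}$ that is sortable by $t$ stacks in series. If $p'$ is the permutation of $\{1,\dots,n\}$ obtained by inserting $n$ into one of the first $t$ positions of $p$ or into the last position of $p$, then $p'$ is also sortable by $t$ stacks in series.
   Context: Sorting with $t$ stacks in series: the positions, ordered from right to left, are the input, stack $1$, ..., stack $t$, and the output. A permutation starts in the input, whose elements are taken in order from left to right. Legal moves: move the next input element onto the top of stack $1$; for $1\le k<t$ move the top of stack $k$ onto the top of stack $k+1$; move the top of stack $t$ to the output. Moves into stacks are legal only if every stack remains increasing from top to bottom (smallest on top). A permutation is sortable by $t$ stacks in series if some sequence of legal moves transfers all elements to the output in increasing order. Inserting $n$ into position $j$ of $p=p_1\cdots p_{n-1}$ means forming $p_1\cdots p_{j-1}\,n\,p_j\cdots p_{n-1}$. -}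

module Defs where

open import Data.Nat using (ℕ; zero; suc; _<_; _∸_)
open import Data.Fin using (Fin; toℕ)
open import Data.List using (List; []; _∷_; _++_; [_]; map; upTo; take; drop)
open import Data.Vec using (Vec; lookup; _[_]≔_; replicate)
open import Data.Unit using (⊤)
open import Data.Product using (Σ; _×_; _,_)
open import Data.List.Relation.Unary.Linked using (Linked)
open import Data.List.Relation.Binary.Permutation.Propositional using (_↭_)
open import Relation.Binary.PropositionalEquality using (_≡_)
open import Relation.Binary.Construct.Closure.ReflexiveTransitive using (Star)

range : ℕ → List ℕ
range m = map suc (upTo m)

-- p is a permutation of {1,...,m}, written in one-line notation
IsPerm : ℕ → List ℕ → Set
IsPerm m p = p ↭ range m

-- A stack is a list, top first.  Pushing x onto s keeps the stack
-- increasing from top to bottom iff s is empty or x < top of s.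
CanPush : ℕ → List ℕ → Set
CanPush x []      = ⊤
CanPush x (y ∷ _) = x < y

-- Configuration for t stacks in series: remaining input (next element first),
-- stacks 1..t (stack i+1 is index i), output (left to right, in order produced).
record Config (t : ℕ) : Set where
  constructor config
  field
    input  : List ℕ
    stacks : Vec (List ℕ) t
    output : List ℕ

data Move {t : ℕ} : Config t → Config t → Set where
  push : ∀ {x xs ss out} (i : Fin t) → toℕ i ≡ 0 → CanPush x (lookup ss i) →
         Move (config (x ∷ xs) ss out) (config xs (ss [ i ]≔ (x ∷ lookup ss i)) out)
  transfer : ∀ {inp ss out x rest} (i j : Fin t) → toℕ j ≡ suc (toℕ i) →
         lookup ss i ≡ x ∷ rest → CanPush x (lookup ss j) →
         Move (config inp ss out)
              (config inp ((ss [ i ]≔ rest) [ j ]≔ (x ∷ lookup ss j)) out)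
  pop : ∀ {inp ss out x rest} (i : Fin t) → suc (toℕ i) ≡ t →
         lookup ss i ≡ x ∷ rest →
         Move (config inp ss out) (config inp (ss [ i ]≔ rest) (out ++ [ x ]))

Sortable : ℕ → List ℕ → Set
Sortable t p = Σ (List ℕ) λ out →
  Star Move (config p (replicate _ []) []) (config {t} [] (replicate _ []) out)
  × Linked _<_ out

-- insert n into position j (1-indexed) of p : p_1..p_{j-1} n p_j ..
insertAt : ℕ → ℕ → List ℕ → List ℕ
insertAt n j p = take (j ∸ 1) p ++ n ∷ drop (j ∸ 1) p

{-# OPTIONS --safe #-}
module Submission where

-- Appending n is easy: sort p, then push n and send it through the empty stacks.
--
-- For n inserted at position j ≤ t, the run sorting p' mirrors a run sorting p move for move.
-- Being the largest element, n can rest at the bottom of stack 1 without ever obstructing a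
-- move, and leave through the empty stacks at the very end; but to push n at all, the mirror
-- needs stack 1 empty when n is read. So it splits each stack k of the mirrored run into an
-- upper part over a lower part, and holds the lower part one stack deeper, under the upper part
-- of stack k + 1. Before n is read, the upper part of stack 1 is kept empty by moving every
-- pushed element straight on to stack 2. A counting argument shows that there is always room
-- for this, because only j - 1 < t elements are read before n.

open import Defs
open import Data.Nat using (ℕ; zero; suc; _≤_; _<_; _+_; _∸_; z≤n; s≤s; z<s)
open import Data.Nat.Properties
open import Data.List using (List; []; _∷_; _++_; _∷ʳ_; [_]; length; take; drop; upTo)
open import Data.List.Properties
  using (length-map; length-upTo; length-take; take-all; drop-all; take++drop≡id)
open import Data.List.Relation.Unary.All as List using ([]; _∷_)
open import Data.List.Relation.Unary.All.Properties using (∷ʳ⁺; map⁺; applyUpTo⁺₁)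
open import Data.List.Relation.Unary.Linked as Linked using (Linked; []; [-]; _∷_)
open import Data.List.Relation.Binary.Permutation.Propositional using (↭-sym)
open import Data.List.Relation.Binary.Permutation.Propositional.Properties using (All-resp-↭; ↭-length)
open import Data.Vec as Vec using (Vec; []; _∷_; lookup; replicate; _[_]≔_)
open import Data.Vec.Relation.Unary.All as Vec using ([]; _∷_)
open import Data.Vec.Properties using (∷-injectiveʳ)
open import Data.Fin using (Fin; zero; suc; toℕ)
open import Data.Product using (∃; _×_; _,_; proj₂)
open import Data.Sum using (_⊎_; inj₁; inj₂)
open import Data.Unit using (tt)
open import Data.Empty using (⊥-elim)
open import Function using (_∘_; id)
open import Relation.Binary.PropositionalEquality
  using (_≡_; refl; sym; trans; cong; cong₂; subst; subst₂)
open import Relation.Binary.Construct.Closure.ReflexiveTransitive as Star using (Star; ε; _◅_; _◅◅_)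

variable
  n : ℕ

data Transfer : Vec (List ℕ) n → Vec (List ℕ) n → Set where
  here  : ∀ {x s₁ s₂} {ss : Vec (List ℕ) n} → CanPush x s₂ →
          Transfer ((x ∷ s₁) ∷ s₂ ∷ ss) (s₁ ∷ (x ∷ s₂) ∷ ss)
  there : ∀ {s} {ss ss' : Vec (List ℕ) n} → Transfer ss ss' → Transfer (s ∷ ss) (s ∷ ss')

data PopLast : Vec (List ℕ) n → Vec (List ℕ) n → ℕ → Set where
  here  : ∀ {x s} → PopLast ((x ∷ s) ∷ []) (s ∷ []) x
  there : ∀ {s x} {ss ss' : Vec (List ℕ) n} → PopLast ss ss' x → PopLast (s ∷ ss) (s ∷ ss') x

data Step {n : ℕ} : Config (suc n) → Config (suc n) → Set where
  push     : ∀ {x xs s ss out} → CanPush x s →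
             Step (config (x ∷ xs) (s ∷ ss) out) (config xs ((x ∷ s) ∷ ss) out)
  transfer : ∀ {inp ss ss' out} → Transfer ss ss' → Step (config inp ss out) (config inp ss' out)
  pop      : ∀ {inp ss ss' out x} → PopLast ss ss' x →
             Step (config inp ss out) (config inp ss' (out ++ [ x ]))

data TransferAt : Vec (List ℕ) n → Vec (List ℕ) n → Set where
  at : ∀ {ss x rest} (i j : Fin n) → toℕ j ≡ suc (toℕ i) → lookup ss i ≡ x ∷ rest →
       CanPush x (lookup ss j) → TransferAt ss ((ss [ i ]≔ rest) [ j ]≔ (x ∷ lookup ss j))

data PopAt : Vec (List ℕ) n → Vec (List ℕ) n → ℕ → Set where
  at : ∀ {ss x rest} (i : Fin n) → suc (toℕ i) ≡ n → lookup ss i ≡ x ∷ rest →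
       PopAt ss (ss [ i ]≔ rest) x

transferAt⇒transfer : {ss ss' : Vec (List ℕ) n} → TransferAt ss ss' → Transfer ss ss'
transferAt⇒transfer {ss = _ ∷ _ ∷ _} (at zero (suc zero) _ refl cp) = here cp
transferAt⇒transfer {ss = _ ∷ _}     (at (suc i) (suc j) e l cp) =
  there (transferAt⇒transfer (at i j (suc-injective e) l cp))

transfer⇒transferAt : {ss ss' : Vec (List ℕ) n} → Transfer ss ss' → TransferAt ss ss'
transfer⇒transferAt (here cp) = at zero (suc zero) refl refl cp
transfer⇒transferAt (there t) with transfer⇒transferAt t
... | at i j e l cp = at (suc i) (suc j) (cong suc e) l cp

popAt⇒popLast : {ss ss' : Vec (List ℕ) n} {x : ℕ} → PopAt ss ss' x → PopLast ss ss' x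
popAt⇒popLast {ss = _ ∷ []}    (at zero _ refl) = here
popAt⇒popLast {ss = _ ∷ _ ∷ _} (at (suc i) e l) = there (popAt⇒popLast (at i (suc-injective e) l))

popLast⇒popAt : {ss ss' : Vec (List ℕ) n} {x : ℕ} → PopLast ss ss' x → PopAt ss ss' x
popLast⇒popAt here      = at zero refl refl
popLast⇒popAt (there p) with popLast⇒popAt p
... | at i e l = at (suc i) (cong suc e) l

move⇒step : {C C' : Config (suc n)} → Move C C' → Step C C'
move⇒step {C = config _ (_ ∷ _) _} (push zero _ cp) = push cp
move⇒step (transfer i j e l cp) = transfer (transferAt⇒transfer (at i j e l cp))
move⇒step (pop i e l)           = pop (popAt⇒popLast (at i e l))

step⇒move : {C C' : Config (suc n)} → Step C C' → Move C C'
step⇒move (push cp) = push zero refl cp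
step⇒move (transfer t) with transfer⇒transferAt t
... | at i j e l cp = transfer i j e l cp
step⇒move (pop p) with popLast⇒popAt p
... | at i e l = pop i e l

Drains : ∀ n → List ℕ → List ℕ → Set
Drains n p out = Star Step (config p (replicate (suc n) []) []) (config [] (replicate (suc n) []) out)

transfers : ∀ {inp out} {ss ss' : Vec (List ℕ) (suc n)} →
            Star Transfer ss ss' → Star Step (config inp ss out) (config inp ss' out)
transfers = Star.gmap _ transfer

sink : ∀ n x → Star Transfer ([ x ] ∷ replicate n []) (replicate n [] Vec.∷ʳ [ x ])
sink zero    x = ε
sink (suc n) x = here tt ◅ Star.gmap _ there (sink n x)

pop-sunk : ∀ n x → PopLast (replicate n [] Vec.∷ʳ [ x ]) (replicate (suc n) []) x
pop-sunk zero    x = here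
pop-sunk (suc n) x = there (pop-sunk n x)

flush : ∀ n x out → Star Step (config [] ([ x ] ∷ replicate n []) out)
                               (config [] (replicate (suc n) []) (out ∷ʳ x))
flush n x out = transfers (sink n x) ◅◅ pop (pop-sunk n x) ◅ ε

step-++-input : ∀ rest {inp inp' ss ss' out out'} →
                Step {n} (config inp ss out) (config inp' ss' out') →
                Step (config (inp ++ rest) ss out) (config (inp' ++ rest) ss' out')
step-++-input rest (push cp)    = push cp
step-++-input rest (transfer t) = transfer t
step-++-input rest (pop p)      = pop p

run-++-input : ∀ rest {C C' : Config (suc n)} → Star Step C C' →
               Star Step (record C { input = Config.input C ++ rest })
                         (record C' { input = Config.input C' ++ rest })
run-++-input rest = Star.gmap _ (step-++-input rest)

preserved : {A : Set} {T : A → A → Set} (P : A → Set) →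
            (∀ {a b} → T a b → P a → P b) → ∀ {a b} → Star T a b → P a → P b
preserved P step = Star.fold (λ a b → P a → P b) (λ t k → k ∘ step t) id

all-replicate : {P : List ℕ → Set} → P [] → ∀ n → Vec.All P (replicate n [])
all-replicate p zero    = []
all-replicate p (suc n) = p ∷ all-replicate p n

Sorted : List ℕ → Set
Sorted = Linked _<_

AllSorted : Vec (List ℕ) n → Set
AllSorted = Vec.All Sorted

sorted-push : ∀ {x s} → CanPush x s → Sorted s → Sorted (x ∷ s)
sorted-push {s = []}    _  _      = [-]
sorted-push {s = _ ∷ _} cp sorted = cp ∷ sorted

sorted-∷ʳ : ∀ {xs y} → Sorted xs → List.All (_< y) xs → Sorted (xs ∷ʳ y)
sorted-∷ʳ []            []           = [-]
sorted-∷ʳ [-]           (x<y ∷ [])   = x<y ∷ [-]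
sorted-∷ʳ (x<x' ∷ rest) (_ ∷ bounds) = x<x' ∷ sorted-∷ʳ rest bounds

transfer-sorted : {ss ss' : Vec (List ℕ) n} → Transfer ss ss' → AllSorted ss → AllSorted ss'
transfer-sorted (here cp) (s₁ ∷ s₂ ∷ ss) = Linked.tail s₁ ∷ sorted-push cp s₂ ∷ ss
transfer-sorted (there t) (s ∷ ss)       = s ∷ transfer-sorted t ss

pop-sorted : {ss ss' : Vec (List ℕ) n} {x : ℕ} → PopLast ss ss' x → AllSorted ss → AllSorted ss'
pop-sorted here      (s ∷ []) = Linked.tail s ∷ []
pop-sorted (there p) (s ∷ ss) = s ∷ pop-sorted p ss

step-sorted : {C C' : Config (suc n)} → Step C C' →
              AllSorted (Config.stacks C) → AllSorted (Config.stacks C')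
step-sorted (push cp)    (s ∷ ss) = sorted-push cp s ∷ ss
step-sorted (transfer t) ss       = transfer-sorted t ss
step-sorted (pop p)      ss       = pop-sorted p ss

run-sorted : {C C' : Config (suc n)} → Star Step C C' →
             AllSorted (Config.stacks C) → AllSorted (Config.stacks C')
run-sorted = preserved (AllSorted ∘ Config.stacks) step-sorted

AllIn : (ℕ → Set) → Config n → Set
AllIn P (config inp ss out) = List.All P inp × Vec.All (List.All P) ss × List.All P out

module _ {P : ℕ → Set} where

  transfer-all : {ss ss' : Vec (List ℕ) n} → Transfer ss ss' →
                 Vec.All (List.All P) ss → Vec.All (List.All P) ss'
  transfer-all (here _)  ((px ∷ s₁) ∷ s₂ ∷ ss) = s₁ ∷ (px ∷ s₂) ∷ ss
  transfer-all (there t) (s ∷ ss)              = s ∷ transfer-all t ss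

  pop-all : {ss ss' : Vec (List ℕ) n} {x : ℕ} → PopLast ss ss' x →
            Vec.All (List.All P) ss → Vec.All (List.All P) ss' × P x
  pop-all here      ((px ∷ s) ∷ []) = s ∷ [] , px
  pop-all (there p) (s ∷ ss)        = let ss' , px = pop-all p ss in s ∷ ss' , px

  step-allIn : {C C' : Config (suc n)} → Step C C' → AllIn P C → AllIn P C'
  step-allIn (push _)     (px ∷ inp , s ∷ ss , out) = inp , (px ∷ s) ∷ ss , out
  step-allIn (transfer t) (inp , ss , out)          = inp , transfer-all t ss , out
  step-allIn (pop p)      (inp , ss , out)          =
    let ss' , px = pop-all p ss in inp , ss' , ∷ʳ⁺ out px

  run-allIn : {C C' : Config (suc n)} → Star Step C C' → AllIn P C → AllIn P C'
  run-allIn = preserved (AllIn P) step-allIn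

canPush-< : ∀ {x y} A → x < y → CanPush y A → CanPush x A
canPush-< []      _   _   = tt
canPush-< (_ ∷ _) x<y y<z = <-trans x<y y<z

canPush-below : ∀ {x} X {A} → Sorted (x ∷ X ++ A) → CanPush x A
canPush-below []      {[]}    _              = tt
canPush-below []      {_ ∷ _} (x<y ∷ _)      = x<y
canPush-below (_ ∷ X) {A}     (x<y ∷ sorted) = canPush-< A x<y (canPush-below X sorted)

canPush-++ : ∀ {x} U {A} → CanPush x U → CanPush x A → CanPush x (U ++ A)
canPush-++ []      _  cp = cp
canPush-++ (_ ∷ _) cp _  = cp

canPush-++-tail : ∀ {x} U {A B} → CanPush x (U ++ B) → CanPush x A → CanPush x (U ++ A)
canPush-++-tail []      _  cp = cp
canPush-++-tail (_ ∷ _) cp _  = cp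

-- Stack k of the mirrored run is split into an upper part X over a lower part A (the last
-- stack has no lower part). The mirror holds X_k ++ A_(k-1) on stack k, where A_0 is [] before
-- n is read and [ n ] afterwards.
infixr 5 _∷_
data Split : ℕ → Set where
  last : List ℕ → Split zero
  _∷_  : List ℕ × List ℕ → Split n → Split (suc n)

stacksOf : Split n → Vec (List ℕ) (suc n)
stacksOf (last X)      = X ∷ []
stacksOf ((X , A) ∷ s) = (X ++ A) ∷ stacksOf s

shifted : List ℕ → Split n → Vec (List ℕ) (suc n)
shifted a (last X)      = (X ++ a) ∷ []
shifted a ((X , A) ∷ s) = (X ++ a) ∷ shifted A s

upper : Split n → List ℕ
upper (last X)      = X
upper ((X , _) ∷ _) = X

pushUpper : ℕ → Split n → Split n
pushUpper x (last X)      = last (x ∷ X)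
pushUpper x ((X , A) ∷ s) = (x ∷ X , A) ∷ s

emptySplit : ∀ n → Split n
emptySplit zero    = last []
emptySplit (suc n) = ([] , []) ∷ emptySplit n

stacksOf-emptySplit : ∀ n → stacksOf (emptySplit n) ≡ replicate (suc n) []
stacksOf-emptySplit zero    = refl
stacksOf-emptySplit (suc n) = cong ([] ∷_) (stacksOf-emptySplit n)

shifted-of-empty : ∀ {a} (s : Split n) → stacksOf s ≡ replicate (suc n) [] →
                   shifted a s ≡ a ∷ replicate n []
shifted-of-empty (last [])       refl = refl
shifted-of-empty (([] , []) ∷ s) eq   = cong (_ ∷_) (shifted-of-empty s (∷-injectiveʳ eq))

transfer-onto-emptyUpper : ∀ {x A B} (s : Split n) → upper s ≡ [] → CanPush x A →
                           Transfer ((x ∷ B) ∷ shifted A s) (B ∷ shifted (x ∷ A) s)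
transfer-onto-emptyUpper (last _) refl cp = here cp
transfer-onto-emptyUpper (_ ∷ _)  refl cp = here cp

-- k is the index of the first stack of s, and M counts the elements still to be read before n
-- together with those on the stacks above k. A nonempty upper part on stack k requires M + 2 ≤ k:
-- Room⁺ asks this of every stack, Room only from the first nonempty upper part on.
Room⁺ : ℕ → ℕ → Split n → Set
Room⁺ k M (last X)      = M + length X < k
Room⁺ k M ((X , A) ∷ s) = 2 + M ≤ k × Room⁺ (suc k) (M + length (X ++ A)) s

Room : ℕ → ℕ → Split n → Set
Room k M (last X)            = M + length X < k
Room k M (([] , A) ∷ s)      = Room (suc k) (M + length A) s
Room k M s@((_ ∷ _ , _) ∷ _) = Room⁺ k M s

room⁺-mono : ∀ {k M M'} (s : Split n) → M' ≤ M → Room⁺ k M s → Room⁺ k M' s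
room⁺-mono (last X)      M'≤M r       = ≤-trans (s≤s (+-monoˡ-≤ _ M'≤M)) r
room⁺-mono ((X , A) ∷ s) M'≤M (g , r) =
  ≤-trans (s≤s (s≤s M'≤M)) g , room⁺-mono s (+-monoˡ-≤ _ M'≤M) r

room-mono : ∀ {k M M'} (s : Split n) → M' ≤ M → Room k M s → Room k M' s
room-mono (last X)            M'≤M r = room⁺-mono (last X) M'≤M r
room-mono (([] , A) ∷ s)      M'≤M r = room-mono s (+-monoˡ-≤ _ M'≤M) r
room-mono s@((_ ∷ _ , _) ∷ _) M'≤M r = room⁺-mono s M'≤M r

room⁺⇒room : ∀ {k M} (s : Split n) → Room⁺ k M s → Room k M s
room⁺⇒room (last X)          r       = r
room⁺⇒room (([] , A) ∷ s)    (_ , r) = room⁺⇒room s r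
room⁺⇒room ((_ ∷ _ , _) ∷ _) r       = r

room⇒room⁺ : ∀ {k M z Z} (s : Split n) → upper s ≡ z ∷ Z → Room k M s → Room⁺ k M s
room⇒room⁺ (last X)          refl r = r
room⇒room⁺ ((_ ∷ _ , _) ∷ _) refl r = r

room⁺-upper : ∀ {k M z Z} (s : Split n) → upper s ≡ z ∷ Z → Room⁺ k M s → 2 + M ≤ k
room⁺-upper {M = M} (last (_ ∷ Z)) refl r       = ≤-trans (s≤s (m<m+n M z<s)) r
room⁺-upper ((_ ∷ _ , _) ∷ _)      refl (g , _) = g

room⇒emptyUpper : ∀ {k M} (s : Split n) → k ≤ suc M → Room k M s → upper s ≡ []
room⇒emptyUpper s k≤1+M r with upper s in eq
... | []    = refl
... | _ ∷ _ = ⊥-elim (<⇒≱ (room⁺-upper s eq (room⇒room⁺ s eq r)) k≤1+M)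

room-emptySplit : ∀ {k M} n → M < k + n → Room k M (emptySplit n)
room-emptySplit {k} {M} zero    M<k   = subst₂ _<_ (sym (+-identityʳ M)) (+-identityʳ k) M<k
room-emptySplit {k} {M} (suc n) M<k+n =
  room-emptySplit n (subst₂ _<_ (sym (+-identityʳ M)) (+-suc k n) M<k+n)

record _≼⟨_⟩_ (s : Split n) (d : ℕ) (s' : Split n) : Set where
  constructor mk≼
  field
    room≼  : ∀ {k M} → Room k (d + M) s → Room k M s'
    room⁺≼ : ∀ {k M} → Room⁺ k (d + M) s → Room⁺ k M s'
open _≼⟨_⟩_

_≼_ : Split n → Split n → Set
s ≼ s' = s ≼⟨ 0 ⟩ s'

∷-≼ : ∀ {X A} {s s' : Split n} → s ≼ s' → ((X , A) ∷ s) ≼ ((X , A) ∷ s')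
∷-≼ {X = []}    (mk≼ r r⁺) = mk≼ r (λ (g , h) → g , r⁺ h)
∷-≼ {X = _ ∷ _} (mk≼ _ r⁺) = mk≼ (λ (g , h) → g , r⁺ h) (λ (g , h) → g , r⁺ h)

popUpper-≼ : ∀ {x X} → last (x ∷ X) ≼ last X
popUpper-≼ {X = X} = mk≼ shrink shrink
  where
  shrink : ∀ {k M} → M + suc (length X) < k → M + length X < k
  shrink {M = M} r = ≤-trans (s≤s (+-monoʳ-≤ M (n≤1+n _))) r

room⁺-pushUpper : ∀ {k M x} (s : Split n) → Room⁺ k (suc M) s → Room⁺ k M (pushUpper x s)
room⁺-pushUpper {M = M} (last X)      r       = ≤-trans (s≤s (≤-reflexive (+-suc M (length X)))) r
room⁺-pushUpper {M = M} ((X , A) ∷ s) (g , r) =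
  ≤-trans (n≤1+n _) g , room⁺-mono s (≤-reflexive (+-suc M (length (X ++ A)))) r

room⁺-pushUpper′ : ∀ {k M L x} (s : Split n) →
                   Room⁺ k (M + suc L) s → Room⁺ k (M + L) (pushUpper x s)
room⁺-pushUpper′ {M = M} s = room⁺-pushUpper s ∘ room⁺-mono s (≤-reflexive (sym (+-suc M _)))

upper→upper : ∀ {x X A} (s : Split n) → ((x ∷ X , A) ∷ s) ≼ ((X , A) ∷ pushUpper x s)
upper→upper {X = []}    s =
  mk≼ (λ (_ , h) → room⁺⇒room _ (room⁺-pushUpper′ s h)) (λ (g , h) → g , room⁺-pushUpper′ s h)
upper→upper {X = _ ∷ _} s =
  mk≼ (λ (g , h) → g , room⁺-pushUpper′ s h) (λ (g , h) → g , room⁺-pushUpper′ s h)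

lower→next : ∀ {x A} {s s' : Split n} → s ≼⟨ 1 ⟩ s' → (([] , x ∷ A) ∷ s) ≼ (([] , A) ∷ s')
lower→next {A = A} {s} (mk≼ r r⁺) =
  mk≼ (λ {_} {M} h → r (room-mono s (≤-reflexive (sym (+-suc M (length A)))) h))
      (λ {_} {M} (g , h) → g , r⁺ (room⁺-mono s (≤-reflexive (sym (+-suc M (length A)))) h))

intoLast-≼ : ∀ {x X} → last X ≼⟨ 1 ⟩ last (x ∷ X)
intoLast-≼ {x = x} {X} = mk≼ (room⁺-pushUpper {x = x} (last X)) (room⁺-pushUpper {x = x} (last X))

intoLower-≼ : ∀ {x A} (s : Split n) → (([] , A) ∷ s) ≼⟨ 1 ⟩ (([] , x ∷ A) ∷ s)
intoLower-≼ {A = A} s =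
  mk≼ (λ {_} {M} h → room-mono s (≤-reflexive (+-suc M (length A))) h)
      (λ {_} {M} (g , h) → ≤-trans (n≤1+n _) g , room⁺-mono s (≤-reflexive (+-suc M (length A))) h)

intoUpper-≼ : ∀ {x A z Z} (s : Split n) → upper s ≡ z ∷ Z →
              (([] , A) ∷ s) ≼⟨ 1 ⟩ (([ x ] , A) ∷ s)
intoUpper-≼ {x = x} {A = A} s eq = mk≼ room (λ (_ , h) → room (room⁺⇒room s h))
  where
  room : ∀ {k M} → Room (suc k) (suc M + length A) s → Room⁺ k M (([ x ] , A) ∷ s)
  room {M = M} h =
    let h⁺ = room⇒room⁺ s eq h
    in  ≤-trans (s≤s (s≤s (m≤m+n M (length A)))) (≤-pred (room⁺-upper s eq h⁺)) ,
        room⁺-mono s (≤-reflexive (+-suc M (length A))) h⁺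

record Mirrored (R : Vec (List ℕ) (suc n) → Vec (List ℕ) (suc n) → Set) (d : ℕ)
                (a : List ℕ) (s : Split n) (cs' : Vec (List ℕ) (suc n)) : Set where
  constructor mirrored
  field
    split'    : Split n
    stacks-eq : cs' ≡ stacksOf split'
    moves     : R (shifted a s) (shifted a split')
    roomier   : s ≼⟨ d ⟩ split'

mirror-transfer : ∀ a (s : Split n) {cs'} → AllSorted (stacksOf s) → AllSorted (shifted a s) →
                  Transfer (stacksOf s) cs' → Mirrored (Star Transfer) 0 a s cs'
mirror-transfer a ((x ∷ X , A) ∷ last X₂) (sorted ∷ _) _ (here cp) =
  mirrored ((X , A) ∷ last (x ∷ X₂)) refl (here (canPush-++ X₂ cp (canPush-below X sorted)) ◅ ε)
    (upper→upper (last X₂))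
mirror-transfer a ((x ∷ X , A) ∷ (X₂ , A₂) ∷ s) (sorted ∷ _) _ (here cp) =
  mirrored ((X , A) ∷ (x ∷ X₂ , A₂) ∷ s) refl
    (here (canPush-++-tail X₂ cp (canPush-below X sorted)) ◅ ε) (upper→upper ((X₂ , A₂) ∷ s))
-- The move needs x < y, but in the mirror y lies above x on one stack.
mirror-transfer a (([] , x ∷ A) ∷ last (y ∷ Y)) _ (_ ∷ sorted ∷ _) (here x<y) =
  ⊥-elim (<-asym x<y (canPush-below Y sorted))
mirror-transfer a (([] , x ∷ A) ∷ (y ∷ Y , _) ∷ _) _ (_ ∷ sorted ∷ _) (here x<y) =
  ⊥-elim (<-asym x<y (canPush-below Y sorted))
mirror-transfer a (([] , x ∷ A) ∷ last []) _ _ (here _) =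
  mirrored (([] , A) ∷ last [ x ]) refl ε (lower→next intoLast-≼)
mirror-transfer a (([] , x ∷ A) ∷ ([] , A₂) ∷ s) _ _ (here cp) with upper s in eq
... | []    = mirrored (([] , A) ∷ ([] , x ∷ A₂) ∷ s) refl
                (there (transfer-onto-emptyUpper s eq cp) ◅ ε) (lower→next (intoLower-≼ s))
... | _ ∷ _ = mirrored (([] , A) ∷ ([ x ] , A₂) ∷ s) refl ε (lower→next (intoUpper-≼ s eq))
mirror-transfer a (last _) _ _ (there ())
mirror-transfer a ((X , A) ∷ s) (_ ∷ sortedC) (_ ∷ sortedD) (there t) =
  let mirrored s' stacks-eq moves roomier = mirror-transfer A s sortedC sortedD t
  in  mirrored ((X , A) ∷ s') (cong ((X ++ A) ∷_) stacks-eq) (Star.gmap _ there moves) (∷-≼ roomier)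

mirror-pop : ∀ a (s : Split n) {cs' x} → PopLast (stacksOf s) cs' x →
             Mirrored (λ u v → PopLast u v x) 0 a s cs'
mirror-pop a (last (_ ∷ X)) here      = mirrored (last X) refl here popUpper-≼
mirror-pop a ((X , A) ∷ s)  (there p) =
  let mirrored s' stacks-eq moves roomier = mirror-pop A s p
  in  mirrored ((X , A) ∷ s') (cong ((X ++ A) ∷_) stacks-eq) (there moves) (∷-≼ roomier)

-- Before n is read, the element pushed by the mirror goes straight on to stack 2.
mirror-push-beforeMax : ∀ {b x xs s₁ out} {ss : Vec (List ℕ) n} (s : Split n) →
                        s₁ ∷ ss ≡ stacksOf s → CanPush x s₁ → Room 1 (suc b) s →
                        Mirrored (λ u v → Star Step (config (x ∷ xs) u out) (config xs v out))
                                 1 [] s ((x ∷ s₁) ∷ ss)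
mirror-push-beforeMax (last _)               refl _  (s≤s ())
mirror-push-beforeMax ((_ ∷ _ , _) ∷ _)      refl _  (s≤s () , _)
mirror-push-beforeMax {x = x} (([] , A) ∷ s) refl cp room =
  let upper₂-empty = room⇒emptyUpper s (s≤s (s≤s z≤n)) room
  in  mirrored (([] , x ∷ A) ∷ s) refl
        (push tt ◅ transfer (transfer-onto-emptyUpper s upper₂-empty cp) ◅ ε) (intoLower-≼ s)

push-afterMax : ∀ {M x xs s₁ out} {ss : Vec (List ℕ) n} (s : Split n) → s₁ ∷ ss ≡ stacksOf s →
                CanPush x s₁ → x < M →
                (x ∷ s₁) ∷ ss ≡ stacksOf (pushUpper x s) ×
                Step (config (x ∷ xs) (shifted [ M ] s) out) (config xs (shifted [ M ] (pushUpper x s)) out)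
push-afterMax (last X)      refl cp x<M = refl , push (canPush-++ X cp x<M)
push-afterMax ((X , A) ∷ s) refl cp x<M = refl , push (canPush-++-tail X cp x<M)

push-max : ∀ {M v out} (s : Split n) → upper s ≡ [] →
           Step (config (M ∷ v) (shifted [] s) out) (config v (shifted [ M ] s) out)
push-max (last _) refl = push tt
push-max (_ ∷ _)  refl = push tt

data Phase (M : ℕ) (s : Split n) : List ℕ → List ℕ → List ℕ → Set where
  before : ∀ y u v → Room 1 (length (y ∷ u)) s → Phase M s (y ∷ u ++ v) (y ∷ u ++ M ∷ v) []
  after  : ∀ {inp} → Phase M s inp inp [ M ]

phase-≼ : ∀ {M} {s s' : Split n} {inC inD a} → s ≼ s' → Phase M s inC inD a → Phase M s' inC inD a
phase-≼ r (before y u v room) = before y u v (room≼ r room)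
phase-≼ r after               = after

data Simulates (M : ℕ) : Config (suc n) → Config (suc n) → Set where
  simulates : ∀ {inC inD cs out a} (s : Split n) → cs ≡ stacksOf s → Phase M s inC inD a →
              AllIn (_< M) (config inC cs out) → AllSorted cs → AllSorted (shifted a s) →
              Simulates M (config inC cs out) (config inD (shifted a s) out)

Reaches : ℕ → Config (suc n) → Config (suc n) → Set
Reaches M C D = ∃ λ D' → Star Step D D' × Simulates M C D'

settle : ∀ {M} u {v cs out} (s : Split n) → cs ≡ stacksOf s → Room 1 (length u) s →
         AllIn (_< M) (config (u ++ v) cs out) → AllSorted cs → AllSorted (shifted [] s) →
         Reaches M (config (u ++ v) cs out) (config (u ++ M ∷ v) (shifted [] s) out)
settle []      s eq room bounded sortedC sortedD =
  let step = push-max s (room⇒emptyUpper s (s≤s z≤n) room)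
  in  _ , step ◅ ε , simulates s eq after bounded sortedC (step-sorted step sortedD)
settle (y ∷ u) s eq room bounded sortedC sortedD =
  _ , ε , simulates s eq (before y u _ room) bounded sortedC sortedD

simulate-step : ∀ {M} {C C' D : Config (suc n)} → Simulates M C D → Step C C' → Reaches M C' D
simulate-step (simulates s eq after bounded@(x<M ∷ _ , _) sortedC sortedD) step@(push cp) =
  let eq' , dstep = push-afterMax s eq cp x<M
  in  _ , dstep ◅ ε ,
      simulates (pushUpper _ s) eq' after (step-allIn step bounded)
        (step-sorted step sortedC) (step-sorted dstep sortedD)
simulate-step (simulates s eq (before y u v room) bounded sortedC sortedD) step@(push cp) =
  let mirrored s' eq' dsteps r = mirror-push-beforeMax s eq cp room
      D' , dsteps' , sim = settle u s' eq' (room≼ r room) (step-allIn step bounded)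
                             (step-sorted step sortedC) (run-sorted dsteps sortedD)
  in  D' , dsteps ◅◅ dsteps' , sim
simulate-step (simulates {a = a} s refl phase bounded sortedC sortedD) step@(transfer t) =
  let mirrored s' eq dsteps r = mirror-transfer a s sortedC sortedD t
  in  _ , transfers dsteps ,
      simulates s' eq (phase-≼ r phase) (step-allIn step bounded)
        (transfer-sorted t sortedC) (preserved AllSorted transfer-sorted dsteps sortedD)
simulate-step (simulates {a = a} s refl phase bounded sortedC sortedD) step@(pop p) =
  let mirrored s' eq dpop r = mirror-pop a s p
  in  _ , pop dpop ◅ ε ,
      simulates s' eq (phase-≼ r phase) (step-allIn step bounded)
        (pop-sorted p sortedC) (pop-sorted dpop sortedD)

simulate : ∀ {M} {C C' D : Config (suc n)} → Simulates M C D → Star Step C C' → Reaches M C' D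
simulate {D = D} sim ε            = D , ε , sim
simulate         sim (step ◅ run) =
  let D₁ , dsteps₁ , sim₁ = simulate-step sim step
      D₂ , dsteps₂ , sim₂ = simulate sim₁ run
  in  D₂ , dsteps₁ ◅◅ dsteps₂ , sim₂

finish : ∀ {M out} {D : Config (suc n)} → Simulates M (config [] (replicate (suc n) []) out) D →
         Star Step D (config [] (replicate (suc n) []) (out ∷ʳ M))
finish {n} {M} {out} (simulates s eq after _ _ _) =
  subst (λ ss → Star Step (config [] ss out) _) (sym (shifted-of-empty s (sym eq))) (flush n M out)

insert-max : ∀ {M out} w v → length w < suc n → List.All (_< M) (w ++ v) →
             Drains n (w ++ v) out → Drains n (w ++ M ∷ v) (out ∷ʳ M)
insert-max {n} {M} {out} w v w<t bounded run =
  let _ , dsteps , sim = settle w (emptySplit n) (sym (stacksOf-emptySplit n)) (room-emptySplit n w<t)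
                           (bounded , all-replicate [] (suc n) , []) (all-replicate [] (suc n))
                           (subst AllSorted (sym shifted-empty) (all-replicate [] (suc n)))
      _ , dsteps' , sim' = simulate sim run
  in  subst (λ ss → Star Step (config (w ++ M ∷ v) ss []) (config [] (replicate (suc n) []) (out ∷ʳ M)))
            shifted-empty (dsteps ◅◅ dsteps' ◅◅ finish sim')
  where
  shifted-empty : shifted [] (emptySplit n) ≡ replicate (suc n) []
  shifted-empty = shifted-of-empty (emptySplit n) (stacksOf-emptySplit n)

insert-early : ∀ {M p out} j → j ≤ suc n → List.All (_< M) p →
               Drains n p out → Drains n (insertAt M j p) (out ∷ʳ M)
insert-early {n} {p = p} {out} j j≤t bounded run =
  insert-max (take (j ∸ 1) p) (drop (j ∸ 1) p) w<t
    (subst (List.All _) (sym split) bounded) (subst (λ q → Drains n q out) (sym split) run)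
  where
  split = take++drop≡id (j ∸ 1) p
  w<t = s≤s (≤-trans (≤-trans (≤-reflexive (length-take (j ∸ 1) p)) (m⊓n≤m _ _)) (∸-monoˡ-≤ 1 j≤t))

insert-last : ∀ {M p out} → Drains n p out → Drains n (p ++ [ M ]) (out ∷ʳ M)
insert-last {n} {M} {out = out} run = run-++-input [ M ] run ◅◅ push tt ◅ flush n M out

insertAt-last : ∀ {m} p → length p ≡ m → insertAt (suc m) (suc m) p ≡ p ++ [ suc m ]
insertAt-last {m} p refl = cong₂ (λ w v → w ++ suc m ∷ v) (take-all m p ≤-refl) (drop-all m p ≤-refl)

range-bounded : ∀ m → List.All (_< suc m) (range m)
range-bounded m = map⁺ (applyUpTo⁺₁ id m s≤s)

length-perm : ∀ {m p} → IsPerm m p → length p ≡ m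
length-perm {m} perm = trans (↭-length perm) (trans (length-map suc (upTo m)) (length-upTo m))

mainTheorem7 : (t : ℕ) → 1 ≤ t → (m : ℕ) → (p : List ℕ) → IsPerm m p →
    Sortable t p → (j : ℕ) → 1 ≤ j → j ≤ suc m → (j ≤ t ⊎ j ≡ suc m) →
    Sortable t (insertAt (suc m) j p)
mainTheorem7 (suc n) _ m p perm (out , run , sorted) j _ _ position =
  out ∷ʳ suc m , Star.map step⇒move (drains position) , sorted-∷ʳ sorted out<M
  where
  drains-p : Drains n p out
  drains-p = Star.map move⇒step run

  p<M : List.All (_< suc m) p
  p<M = All-resp-↭ (↭-sym perm) (range-bounded m)

  out<M : List.All (_< suc m) out
  out<M = proj₂ (proj₂ (run-allIn drains-p (p<M , all-replicate [] (suc n) , [])))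

  drains : j ≤ suc n ⊎ j ≡ suc m → Drains n (insertAt (suc m) j p) (out ∷ʳ suc m)
  drains (inj₁ j≤t)  = insert-early j j≤t p<M drains-p
  drains (inj₂ refl) =
    subst (λ q → Drains n q _) (sym (insertAt-last p (length-perm perm))) (insert-last drains-p)
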